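{- Let $G=(A,B,E)$ be a bipartite graph, let $k>0$ and let $d\ge\operatorname{deg}_{\max}\mathrm{semi}(A,B,E)$. Furthermore, let $E'\subseteq E$ be a subset of edges such that for all $a\in A$: $\deg_{E'}(a)=\min\{k,\deg_E(a)\}$. Then there is an incomplete $d$-bounded semi-matching $S\subseteq E'$ such that $|S|\ge\min\{kd,|A|\}$.
   Context: $\deg_F(v)$ is the number of edges of $F$ at $v$; $\operatorname{deg}_{\max}F=\max_v\deg_F(v)$. A semi-matching of $(A,B,E)$ is $S\subseteq E$ with $\deg_S(a)=1$ for all $a\in A$. A degree-minimizing path with respect to $S$ is a path $b_1,a_1,b_2,\dots,a_{k-1},b_k$ with $(a_i,b_i)\in S$, $(a_i,b_{i+1})\in E\setminus S$, $\deg_S(b_1)\ge\deg_S(b_k)+2$; an optimal semi-matching admits none, and $\mathrm{semi}(A,B,E)$ denotes an optimal semi-matching (its maximum degree is the same for all optimal ones and equals the minimum over all semi-matchings; the notation presupposes every vertex of $A$ has a neighbor). An incomplete $d$-bounded semi-matching is a set $S\subseteq E$ with $\deg_S(a)\le1$ for all $a\in A$ and $\deg_S(b)\le d$ for all $b\in B$. -}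

module Defs where

open import Data.Nat using (ℕ; zero; suc; _+_; _⊔_; _≤_)
open import Data.Fin using (Fin; zero; suc)
open import Data.Bool using (Bool; true; false; if_then_else_)
open import Data.Product using (_×_)
open import Relation.Binary.PropositionalEquality using (_≡_)

-- A bipartite graph (A,B,E) with A = Fin m, B = Fin n; an edge set is a
-- Boolean-valued relation: F a b ≡ true iff (a,b) ∈ F.
EdgeSet : ℕ → ℕ → Set
EdgeSet m n = Fin m → Fin n → Bool

countFin : ∀ n → (Fin n → Bool) → ℕ
countFin zero    p = 0
countFin (suc n) p = (if p zero then 1 else 0) + countFin n (λ i → p (suc i))

maxFin : ∀ n → (Fin n → ℕ) → ℕ
maxFin zero    f = 0
maxFin (suc n) f = f zero ⊔ maxFin n (λ i → f (suc i))

_⊆ₑ_ : ∀ {m n} → EdgeSet m n → EdgeSet m n → Set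
F ⊆ₑ G = ∀ a b → F a b ≡ true → G a b ≡ true

degA : ∀ {m n} → EdgeSet m n → Fin m → ℕ
degA {m} {n} F a = countFin n (λ b → F a b)

degB : ∀ {m n} → EdgeSet m n → Fin n → ℕ
degB {m} {n} F b = countFin m (λ a → F a b)

degMax : ∀ {m n} → EdgeSet m n → ℕ
degMax {m} {n} F = maxFin m (degA F) ⊔ maxFin n (degB F)

sumFin : ∀ n → (Fin n → ℕ) → ℕ
sumFin zero    f = 0
sumFin (suc n) f = f zero + sumFin n (λ i → f (suc i))

size : ∀ {m n} → EdgeSet m n → ℕ
size {m} {n} F = sumFin m (degA F)

SemiMatching : ∀ {m n} → EdgeSet m n → EdgeSet m n → Set
SemiMatching E S = S ⊆ₑ E × (∀ a → degA S a ≡ 1)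

-- optimal semi-matching: a semi-matching whose maximum degree is minimum
-- among all semi-matchings (the only property of semi(A,B,E) used here)
OptimalSemiMatching : ∀ {m n} → EdgeSet m n → EdgeSet m n → Set
OptimalSemiMatching E S =
  SemiMatching E S × (∀ S' → SemiMatching E S' → degMax S ≤ degMax S')

IncompleteBounded : ∀ {m n} → ℕ → EdgeSet m n → EdgeSet m n → Set
IncompleteBounded d E S =
  S ⊆ₑ E × (∀ a → degA S a ≤ 1) × (∀ b → degB S b ≤ d)

-- Restrict a semi-matching S of maximum degree at most d to E'. A vertex a loses its S-edge
-- only if that edge lies in E \ E'; then deg_E'(a) < deg_E(a), so deg_E'(a) = k. Now match the
-- unmatched vertices greedily to E'-neighbours of load below d, keeping every load at most d.
-- If some vertex finds no such neighbour, its k E'-neighbours all have load d, and double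
-- counting gives at least kd edges; otherwise every vertex of A ends up matched.
module Submission where

open import Defs
open import Data.Nat using (ℕ; zero; suc; _+_; _*_; _⊓_; _≤_; _<_; z≤n; s≤s)
open import Data.Nat.Properties hiding (_≟_; suc-injective)
open import Data.Fin using (Fin; zero; suc)
open import Data.Fin.Properties using (_≟_; any?; suc-injective)
open import Data.Bool using (Bool; true; false; if_then_else_)
import Data.Bool.Properties as Bool
open import Data.Maybe using (Maybe; just; nothing)
import Data.Maybe.Properties as Maybe
open import Data.Product using (Σ; ∃; _×_; _,_; proj₁; proj₂)
open import Data.Sum using (_⊎_; inj₁; inj₂; [_,_])
import Data.Sum as Sum
open import Data.List using ([]; _∷_; allFin)
open import Data.List.Relation.Unary.All as All using (All; []; _∷_)
open import Data.List.Membership.Propositional.Properties using (∈-allFin)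
open import Function using (_∘_; id)
open import Relation.Nullary.Decidable using (Dec; does; yes; no; _because_; _×-dec_; dec-true)
open import Relation.Nullary.Reflects using (invert)
open import Relation.Nullary.Negation using (contradiction)
open import Relation.Binary.PropositionalEquality using (_≡_; _≢_; refl; sym; trans; cong; cong₂; subst; module ≡-Reasoning)
open import Algebra.Properties.CommutativeMonoid.Sum +-0-commutativeMonoid using (sum; ∑-comm; sum-cong-≗)

does-true : ∀ {p} {P : Set p} (P? : Dec P) → does P? ≡ true → P
does-true (true because [p]) _ = invert [p]

m⊓n<n⇒m⊓n≡m : ∀ {m n} → m ⊓ n < n → m ⊓ n ≡ m
m⊓n<n⇒m⊓n≡m {m} {n} m⊓n<n with ⊓-sel m n
... | inj₁ m⊓n≡m = m⊓n≡m
... | inj₂ m⊓n≡n = contradiction (subst (_< n) m⊓n≡n m⊓n<n) (<-irrefl refl)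

indicator : Bool → ℕ
indicator x = if x then 1 else 0

indicator-mono : ∀ {x y} → (x ≡ true → y ≡ true) → indicator x ≤ indicator y
indicator-mono {false} _ = z≤n
indicator-mono {true} {true} _ = ≤-refl
indicator-mono {true} {false} x⇒y with x⇒y refl
... | ()

indicator≤1 : ∀ x → indicator x ≤ 1
indicator≤1 false = z≤n
indicator≤1 true = ≤-refl

count-false : ∀ n → countFin n (λ _ → false) ≡ 0
count-false zero = refl
count-false (suc n) = count-false n

count-≟ : ∀ {n} (y : Fin n) → countFin n (λ x → does (y ≟ x)) ≡ 1
count-≟ {suc n} zero = cong suc (count-false n)
count-≟ (suc y) = count-≟ y

count-mono : ∀ {n} {p q : Fin n → Bool} →
  (∀ x → p x ≡ true → q x ≡ true) → countFin n p ≤ countFin n q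
count-mono {zero} _ = z≤n
count-mono {suc n} p⊆q = +-mono-≤ (indicator-mono (p⊆q zero)) (count-mono (p⊆q ∘ suc))

count-≤-suc : ∀ {n} {p q : Fin n → Bool} (a : Fin n) →
  (∀ x → x ≢ a → q x ≡ true → p x ≡ true) → countFin n q ≤ suc (countFin n p)
count-≤-suc {suc n} {p} zero q⊆p∪a =
  +-mono-≤ (indicator≤1 _)
           (≤-trans (count-mono (λ x → q⊆p∪a (suc x) λ ())) (m≤n+m _ (indicator (p zero))))
count-≤-suc {suc n} (suc a) q⊆p∪a =
  ≤-trans (+-mono-≤ (indicator-mono (q⊆p∪a zero λ ()))
                    (count-≤-suc a λ x x≢a → q⊆p∪a (suc x) (x≢a ∘ suc-injective)))
          (≤-reflexive (+-suc _ _))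

count-< : ∀ {n} {p q : Fin n → Bool} → (∀ x → p x ≡ true → q x ≡ true) →
  (a : Fin n) → p a ≡ false → q a ≡ true → countFin n p < countFin n q
count-< {suc n} p⊆q zero pa qa rewrite pa | qa = s≤s (count-mono (p⊆q ∘ suc))
count-< {suc n} p⊆q (suc a) pa qa =
  ≤-trans (≤-reflexive (sym (+-suc _ _)))
          (+-mono-≤ (indicator-mono (p⊆q zero)) (count-< (p⊆q ∘ suc) a pa qa))

count-witness : ∀ {n} (p : Fin n → Bool) {c} → countFin n p ≡ suc c → ∃ λ x → p x ≡ true
count-witness {suc n} p count≡suc with p zero in p0
... | true = zero , p0
... | false with count-witness (p ∘ suc) count≡suc
... | x , px = suc x , px

count*≤sumFin : ∀ {n} (p : Fin n → Bool) {c} (g : Fin n → ℕ) →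
  (∀ x → p x ≡ true → c ≤ g x) → countFin n p * c ≤ sumFin n g
count*≤sumFin {zero} p g _ = z≤n
count*≤sumFin {suc n} p g c≤g with p zero in p0
... | true = +-mono-≤ (c≤g zero p0) (count*≤sumFin (p ∘ suc) (g ∘ suc) (c≤g ∘ suc))
... | false = ≤-trans (count*≤sumFin (p ∘ suc) (g ∘ suc) (c≤g ∘ suc)) (m≤n+m _ (g zero))

sumFin≡sum : ∀ {n} (f : Fin n → ℕ) → sumFin n f ≡ sum f
sumFin≡sum {zero} f = refl
sumFin≡sum {suc n} f = cong (f zero +_) (sumFin≡sum (f ∘ suc))

countFin≡sum : ∀ {n} (p : Fin n → Bool) → countFin n p ≡ sum (indicator ∘ p)
countFin≡sum {zero} p = refl
countFin≡sum {suc n} p = cong (indicator (p zero) +_) (countFin≡sum (p ∘ suc))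

sumFin-ones : ∀ {n} (f : Fin n → ℕ) → (∀ i → f i ≡ 1) → sumFin n f ≡ n
sumFin-ones {zero} f _ = refl
sumFin-ones {suc n} f f≡1 = cong₂ _+_ (f≡1 zero) (sumFin-ones (f ∘ suc) (f≡1 ∘ suc))

maxFin-≥ : ∀ {n} (f : Fin n → ℕ) i → f i ≤ maxFin n f
maxFin-≥ f zero = m≤m⊔n _ _
maxFin-≥ f (suc i) = ≤-trans (maxFin-≥ (f ∘ suc) i) (m≤n⊔m _ _)

module _ {m n : ℕ} where

  degB≤degMax : (F : EdgeSet m n) (b : Fin n) → degB F b ≤ degMax F
  degB≤degMax F b = ≤-trans (maxFin-≥ (degB F) b) (m≤n⊔m _ _)

  size≡sumFin-degB : (F : EdgeSet m n) → size F ≡ sumFin n (degB F)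
  size≡sumFin-degB F = begin
    sumFin m (degA F)                          ≡⟨ sumFin≡sum (degA F) ⟩
    sum (λ a → countFin n (F a))               ≡⟨ sum-cong-≗ (λ a → countFin≡sum (F a)) ⟩
    sum (λ a → sum (λ b → indicator (F a b)))  ≡⟨ ∑-comm (λ a b → indicator (F a b)) ⟩
    sum (λ b → sum (λ a → indicator (F a b)))  ≡⟨ sum-cong-≗ (λ b → sym (countFin≡sum (λ a → F a b))) ⟩
    sum (degB F)                               ≡⟨ sym (sumFin≡sum (degB F)) ⟩
    sumFin n (degB F)                          ∎
    where open ≡-Reasoning

  saturated⇒degA*≤size : (F G : EdgeSet m n) (a : Fin m) {d : ℕ} →
    (∀ b → G a b ≡ true → d ≤ degB F b) → degA G a * d ≤ size F
  saturated⇒degA*≤size F G a saturated =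
    ≤-trans (count*≤sumFin (G a) (degB F) saturated) (≤-reflexive (sym (size≡sumFin-degB F)))

-- Incomplete semi-matchings are handled as partial maps A ⇀ B, so that deg(a) ≤ 1 is automatic.
Assignment : ℕ → ℕ → Set
Assignment m n = Fin m → Maybe (Fin n)

graph : ∀ {m n} → Assignment m n → EdgeSet m n
graph f a b = does (Maybe.≡-dec _≟_ (f a) (just b))

module _ {m n : ℕ} where

  Matched : Assignment m n → Fin m → Set
  Matched f a = ∃ λ b → f a ≡ just b

  _⊑_ : Assignment m n → Assignment m n → Set
  f ⊑ g = ∀ a → Matched f a → Matched g a

  ⊑-refl : ∀ {f : Assignment m n} → f ⊑ f
  ⊑-refl _ = id

  ⊑-trans : ∀ {f g h : Assignment m n} → f ⊑ g → g ⊑ h → f ⊑ h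
  ⊑-trans f⊑g g⊑h a = g⊑h a ∘ f⊑g a

  assign : Assignment m n → Fin m → Fin n → Assignment m n
  assign f a b x = if does (x ≟ a) then just b else f x

  graph-just : ∀ (f : Assignment m n) {a b} → graph f a b ≡ true → f a ≡ just b
  graph-just f {a} {b} = does-true (Maybe.≡-dec _≟_ (f a) (just b))

  degA-graph≤1 : ∀ (f : Assignment m n) a → degA (graph f) a ≤ 1
  degA-graph≤1 f a with f a
  ... | nothing = ≤-trans (≤-reflexive (count-false n)) z≤n
  ... | just y = ≤-reflexive (count-≟ y)

  degA-graph-matched : ∀ (f : Assignment m n) {a} → Matched f a → degA (graph f) a ≡ 1
  degA-graph-matched f (y , fa≡y) rewrite fa≡y = count-≟ y

  size-graph-total : ∀ (f : Assignment m n) → (∀ a → Matched f a) → size (graph f) ≡ m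
  size-graph-total f total = sumFin-ones (degA (graph f)) (degA-graph-matched f ∘ total)

  assign-matched : ∀ (f : Assignment m n) a b → Matched (assign f a b) a
  assign-matched f a b rewrite dec-true (a ≟ a) refl = b , refl

  ⊑-assign : ∀ (f : Assignment m n) a b → f ⊑ assign f a b
  ⊑-assign f a b x (y , fx≡y) with does (x ≟ a)
  ... | true = b , refl
  ... | false = y , fx≡y

  graph-assign : ∀ (f : Assignment m n) {a b x c} → graph (assign f a b) x c ≡ true →
    (x ≡ a × b ≡ c) ⊎ graph f x c ≡ true
  graph-assign f {a} {b} {x} {c} edge with x ≟ a
  ... | yes x≡a = inj₁ (x≡a , does-true (b ≟ c) edge)
  ... | no _ = inj₂ edge

  assign-bounded : ∀ {E' : EdgeSet m n} {d} (f : Assignment m n) {a b} →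
    IncompleteBounded d E' (graph f) → E' a b ≡ true → degB (graph f) b < d →
    IncompleteBounded d E' (graph (assign f a b))
  assign-bounded {E'} {d} f {a} {b} (graph⊆E' , _ , load≤d) ab load<d =
    graph'⊆E' , degA-graph≤1 (assign f a b) , load'≤d
    where
    graph'⊆E' : graph (assign f a b) ⊆ₑ E'
    graph'⊆E' x c edge with graph-assign f {a} {b} {x} {c} edge
    ... | inj₁ (refl , refl) = ab
    ... | inj₂ old = graph⊆E' x c old

    load'≤d : ∀ c → degB (graph (assign f a b)) c ≤ d
    load'≤d c with b ≟ c
    ... | yes refl = ≤-trans (count-≤-suc a λ x x≢a →
                       [ (λ (x≡a , _) → contradiction x≡a x≢a) , id ] ∘ graph-assign f {a} {b} {x})
                     load<d
    ... | no b≢c = ≤-trans (count-mono λ x →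
                     [ (λ (_ , b≡c) → contradiction b≡c b≢c) , id ] ∘ graph-assign f {a} {b} {x})
                   (load≤d c)

module Greedy {m n : ℕ} (E' : EdgeSet m n) (k d : ℕ) where

  MatchedOrDegK : Assignment m n → Fin m → Set
  MatchedOrDegK f a = Matched f a ⊎ degA E' a ≡ k

  Outcome : Assignment m n → (Assignment m n → Set) → Set
  Outcome f Goal =
    ∃ λ g → IncompleteBounded d E' (graph g) × f ⊑ g × (k * d ≤ size (graph g) ⊎ Goal g)

  match : ∀ f a → IncompleteBounded d E' (graph f) → MatchedOrDegK f a →
    Outcome f (λ g → Matched g a)
  match f a bounded (inj₁ matched) = f , bounded , ⊑-refl , inj₂ matched
  match f a bounded (inj₂ degk) with any? (λ b → (E' a b Bool.≟ true) ×-dec (degB (graph f) b <? d))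
  ... | yes (b , ab , load<d) =
    assign f a b , assign-bounded f bounded ab load<d , ⊑-assign f a b , inj₂ (assign-matched f a b)
  ... | no ¬free = f , bounded , ⊑-refl , inj₁ (subst (λ x → x * d ≤ size (graph f)) degk
    (saturated⇒degA*≤size (graph f) E' a λ b ab → ≮⇒≥ λ load<d → ¬free (b , ab , load<d)))

  match-all : ∀ xs f → IncompleteBounded d E' (graph f) → (∀ a → MatchedOrDegK f a) →
    Outcome f (λ g → All (Matched g) xs)
  match-all [] f bounded _ = f , bounded , ⊑-refl , inj₂ []
  match-all (a ∷ xs) f bounded invariant with match f a bounded (invariant a)
  ... | g , bounded' , f⊑g , inj₁ full = g , bounded' , f⊑g , inj₁ full
  ... | g , bounded' , f⊑g , inj₂ ga
    with match-all xs g bounded' (λ x → Sum.map₁ (f⊑g x) (invariant x))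
  ... | h , bounded'' , g⊑h , result =
    h , bounded'' , ⊑-trans f⊑g g⊑h , Sum.map₂ (g⊑h a ga ∷_) result

  restrict-semiMatching : ∀ {E S : EdgeSet m n} → SemiMatching E S → (∀ b → degB S b ≤ d) →
    E' ⊆ₑ E → (∀ a → degA E' a ≡ k ⊓ degA E a) →
    ∃ λ f → IncompleteBounded d E' (graph f) × ∀ a → MatchedOrDegK f a
  restrict-semiMatching {E} {S} (S⊆E , degS≡1) loadS≤d E'⊆E degE' =
    f , (graph⊆E' , degA-graph≤1 f , load≤d) , matchedOrDegK
    where
    σ : Fin m → Fin n
    σ a = proj₁ (count-witness (S a) (degS≡1 a))

    Sσ : ∀ a → S a (σ a) ≡ true
    Sσ a = proj₂ (count-witness (S a) (degS≡1 a))

    f : Assignment m n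
    f a = if E' a (σ a) then just (σ a) else nothing

    f-just : ∀ {a b} → f a ≡ just b → σ a ≡ b × E' a (σ a) ≡ true
    f-just {a} fa≡b with E' a (σ a) | fa≡b
    ... | true | refl = refl , refl

    graph⊆E' : graph f ⊆ₑ E'
    graph⊆E' a b edge =
      let σa≡b , e = f-just (graph-just f edge) in subst (λ c → E' a c ≡ true) σa≡b e

    load≤d : ∀ b → degB (graph f) b ≤ d
    load≤d b = ≤-trans (count-mono λ a edge →
                          subst (λ c → S a c ≡ true) (proj₁ (f-just (graph-just f edge))) (Sσ a))
                       (loadS≤d b)

    matchedOrDegK : ∀ a → MatchedOrDegK f a
    matchedOrDegK a with E' a (σ a) in e
    ... | true = inj₁ (σ a , refl)
    ... | false = inj₂ (trans (degE' a) (m⊓n<n⇒m⊓n≡m (subst (_< degA E a) (degE' a) degE'<degE)))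
      where
      degE'<degE : degA E' a < degA E a
      degE'<degE = count-< (E'⊆E a) (σ a) e (S⊆E a (σ a) (Sσ a))

lemma1 : ∀ {m n : ℕ} (E : EdgeSet m n) (k d : ℕ) → 0 < k →
    (Sopt : EdgeSet m n) → OptimalSemiMatching E Sopt → degMax Sopt ≤ d →
    (E' : EdgeSet m n) → E' ⊆ₑ E → (∀ a → degA E' a ≡ k ⊓ degA E a) →
    Σ (EdgeSet m n) λ S → IncompleteBounded d E' S × (k * d) ⊓ m ≤ size S
lemma1 {m} E k d _ Sopt (semiMatching , _) maxSopt≤d E' E'⊆E degE'
  with Greedy.restrict-semiMatching E' k d semiMatching (λ b → ≤-trans (degB≤degMax Sopt b) maxSopt≤d) E'⊆E degE'
... | f , bounded , invariant with Greedy.match-all E' k d (allFin m) f bounded invariant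
... | g , bounded' , _ , inj₁ full = graph g , bounded' , ≤-trans (m⊓n≤m _ _) full
... | g , bounded' , _ , inj₂ allMatched = graph g , bounded' ,
      ≤-trans (m⊓n≤n _ _) (≤-reflexive (sym (size-graph-total g λ a → All.lookup allMatched (∈-allFin a))))
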